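{- Let $r \geq 1$ be an integer. Then for every integer $n \geq 0$, $$\sum_{k=0}^{n} (-1)^k \frac{k!}{k+r}\, S(n,k) = \frac{1}{(r-1)!}\sum_{k=0}^{r-1} |s(r,k+1)|\, B_{n+k}.$$
   Context: $X^{\underline{n}} := X(X-1)\cdots(X-n+1)$. The (signed) Stirling numbers of the first kind $s(n,k)$ are defined by $X^{\underline{n}} = \sum_{k=0}^{n} s(n,k) X^k$, and the Stirling numbers of the second kind $S(n,k)$ by $X^n = \sum_{k=0}^{n} S(n,k) X^{\underline{k}}$ ($n\ge0$). The Bernoulli numbers $B_n$ are defined by $\frac{t}{e^t-1} = \sum_{n\ge 0} B_n \frac{t^n}{n!}$. -}

module Defs where

open import Data.Nat as ℕ using (ℕ; zero; suc)
open import Data.Nat.Combinatorics using (_C_)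
open import Data.Nat using (_!)
open import Data.Nat.Properties using (_!≢0)
open import Data.Integer as ℤ using (ℤ; +_)
open import Data.Rational as ℚ using (ℚ; _/_; 0ℚ; 1ℚ)
open import Data.Fin using (Fin; toℕ)
open import Data.Vec using (Vec; []; _∷_; _∷ʳ_; last; foldr; zipWith; allFin)

Σ< : ℕ → (ℕ → ℚ) → ℚ
Σ< zero f = 0ℚ
Σ< (suc n) f = Σ< n f ℚ.+ f n

Σ≤ : ℕ → (ℕ → ℚ) → ℚ
Σ≤ n f = Σ< (suc n) f

-- signed Stirling numbers of the first kind s(n,k):
-- X(X-1)...(X-n+1) = Σ s(n,k) X^k, equivalently
-- s(n+1,k+1) = s(n,k) - n s(n,k+1)
stirling1 : ℕ → ℕ → ℤ
stirling1 zero zero = + 1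
stirling1 zero (suc k) = + 0
stirling1 (suc n) zero = + 0
stirling1 (suc n) (suc k) = stirling1 n k ℤ.- (+ n) ℤ.* stirling1 n (suc k)

-- Stirling numbers of the second kind S(n,k):
-- X^n = Σ S(n,k) X(X-1)...(X-k+1), equivalently
-- S(n+1,k+1) = S(n,k) + (k+1) S(n,k+1)
stirling2 : ℕ → ℕ → ℕ
stirling2 zero zero = 1
stirling2 zero (suc k) = 0
stirling2 (suc n) zero = 0
stirling2 (suc n) (suc k) = stirling2 n k ℕ.+ suc k ℕ.* stirling2 n (suc k)

-- Bernoulli numbers with t/(e^t - 1) = Σ B_n t^n/n!  (so B_1 = -1/2),
-- equivalently B_0 = 1 and Σ_{k=0}^{m} C(m+1,k) B_k = 0 for m ≥ 1.
-- bernoulliVec n = [B_0, ..., B_n]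
bernoulliVec : (n : ℕ) → Vec ℚ (suc n)
bernoulliVec zero = 1ℚ ∷ []
bernoulliVec (suc m) = prev ∷ʳ next
  where
  prev : Vec ℚ (suc m)
  prev = bernoulliVec m
  partial : ℚ
  partial = foldr (λ _ → ℚ) ℚ._+_ 0ℚ
              (zipWith (λ (i : Fin (suc m)) b → ((+ (suc (suc m) C toℕ i)) / 1) ℚ.* b)
                       (allFin (suc m)) prev)
  next : ℚ
  next = ℚ.- (partial ℚ.* ((+ 1) / suc (suc m)))

bernoulli : ℕ → ℚ
bernoulli n = last (bernoulliVec n)

ℕ→ℚ : ℕ → ℚ
ℕ→ℚ k = (+ k) / 1

ℤ→ℚ : ℤ → ℚ
ℤ→ℚ z = z / 1

signPow : ℕ → ℚ
signPow zero = 1ℚ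
signPow (suc k) = ℚ.- signPow k

invFactorial : ℕ → ℚ
invFactorial j = _/_ (+ 1) (j !) {{j !≢0}}

{-# OPTIONS --safe #-}
module Submission where

-- Write L(r,n) and R(r,n) for the two sides. For r = 1 the right side is B_n, and
-- L(1,n) = Σ_k (-1)^k k!/(k+1) S(n,k) is the classical formula for B_n: it satisfies the
-- recurrence Σ_{k≤m+1} C(m+2,k) B_k = 0 defining the Bernoulli numbers, because
-- Σ_j C(N,j) S(j,k) = S(N+1,k+1) and Σ_k (-1)^k k! S(N+1,k+1) telescopes to S(N,0) = 0.
-- Both F = L and F = R satisfy r (F(r+1,n) - F(r,n)) = F(r,n+1). On the left,
-- S(n+1,k) = S(n,k-1) + k S(n,k) turns the weights c_r(k) = (-1)^k k!/(r+k) into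
-- c_r(k+1) + k c_r(k) = r (c_{r+1}(k) - c_r(k)), a partial-fraction identity;
-- on the right, |s(r+1,k+1)| = |s(r,k)| + r |s(r,k+1)|.

open import Defs
open import Data.Nat as ℕ using (ℕ; zero; suc; _!; NonZero)
import Data.Nat.Properties as ℕ
open import Data.Nat.Combinatorics using (_C_; nCk+nC[k+1]≡[n+1]C[k+1]; k>n⇒nCk≡0; nCk≡nC[n∸k]; nC1≡n; nCn≡1)
open import Data.Nat.Induction using (<-rec)
open import Data.Integer as ℤ using (ℤ; +_; ∣_∣; -1ℤ; _^_)
import Data.Integer.Tactic.RingSolver as ℤ-Solver
import Data.Integer.Properties as ℤ
open import Data.Rational as ℚ using (ℚ; 0ℚ; 1ℚ; _+_; _*_; -_; _-_; _/_)
import Data.Rational.Properties as ℚ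
open import Data.Rational.Unnormalised as ℚᵘ using (mkℚᵘ)
import Data.Rational.Unnormalised.Properties as ℚᵘ
open import Data.Fin using (Fin; toℕ)
open import Data.Vec using (Vec; _∷_; _∷ʳ_; tabulate; zipWith; foldr; allFin)
open import Data.Vec.Properties using (last-∷ʳ)
open import Function using (_∘_; id)
open import Relation.Binary.PropositionalEquality
open import Data.Rational.Solver using (module +-*-Solver)
open +-*-Solver using (solve; _:=_; con; _:+_; _:*_; _:-_; :-_)

-- Naturals and their reciprocals in ℚ

fromℚᵘ-homo-+ : ∀ p q → ℚ.fromℚᵘ (p ℚᵘ.+ q) ≡ ℚ.fromℚᵘ p + ℚ.fromℚᵘ q
fromℚᵘ-homo-+ p q = ℚ.toℚᵘ-injective (ℚᵘ.≃-sym
  (ℚᵘ.≃-trans (ℚ.toℚᵘ-homo-+ (ℚ.fromℚᵘ p) (ℚ.fromℚᵘ q))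
    (ℚᵘ.≃-trans (ℚᵘ.+-cong (ℚ.toℚᵘ-fromℚᵘ p) (ℚ.toℚᵘ-fromℚᵘ q))
      (ℚᵘ.≃-sym (ℚ.toℚᵘ-fromℚᵘ (p ℚᵘ.+ q))))))

fromℚᵘ-homo-* : ∀ p q → ℚ.fromℚᵘ (p ℚᵘ.* q) ≡ ℚ.fromℚᵘ p * ℚ.fromℚᵘ q
fromℚᵘ-homo-* p q = ℚ.toℚᵘ-injective (ℚᵘ.≃-sym
  (ℚᵘ.≃-trans (ℚ.toℚᵘ-homo-* (ℚ.fromℚᵘ p) (ℚ.fromℚᵘ q))
    (ℚᵘ.≃-trans (ℚᵘ.*-cong (ℚ.toℚᵘ-fromℚᵘ p) (ℚ.toℚᵘ-fromℚᵘ q))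
      (ℚᵘ.≃-sym (ℚ.toℚᵘ-fromℚᵘ (p ℚᵘ.* q))))))

fromℚᵘ-*≡* : ∀ p q → ℚᵘ.↥ p ℤ.* ℚᵘ.↧ q ≡ ℚᵘ.↥ q ℤ.* ℚᵘ.↧ p → ℚ.fromℚᵘ p ≡ ℚ.fromℚᵘ q
fromℚᵘ-*≡* p q eq = ℚ.fromℚᵘ-cong {p} {q} (ℚᵘ.*≡* eq)

ℕ→ℚ-homo-+ : ∀ a b → ℕ→ℚ (a ℕ.+ b) ≡ ℕ→ℚ a + ℕ→ℚ b
ℕ→ℚ-homo-+ a b = trans
  (fromℚᵘ-*≡* (mkℚᵘ (+ (a ℕ.+ b)) 0) (mkℚᵘ (+ a) 0 ℚᵘ.+ mkℚᵘ (+ b) 0)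
    (cong (ℤ._* + 1) (trans (ℤ.pos-+ a b) (sym (cong₂ ℤ._+_ (ℤ.*-identityʳ (+ a)) (ℤ.*-identityʳ (+ b)))))))
  (fromℚᵘ-homo-+ (mkℚᵘ (+ a) 0) (mkℚᵘ (+ b) 0))

ℕ→ℚ-homo-* : ∀ a b → ℕ→ℚ (a ℕ.* b) ≡ ℕ→ℚ a * ℕ→ℚ b
ℕ→ℚ-homo-* a b = trans
  (fromℚᵘ-*≡* (mkℚᵘ (+ (a ℕ.* b)) 0) (mkℚᵘ (+ a) 0 ℚᵘ.* mkℚᵘ (+ b) 0) (cong (ℤ._* + 1) (ℤ.pos-* a b)))
  (fromℚᵘ-homo-* (mkℚᵘ (+ a) 0) (mkℚᵘ (+ b) 0))

1/ℕ : (d : ℕ) → .{{NonZero d}} → ℚ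
1/ℕ d = + 1 / d

n/d≡n*1/d : ∀ n d .{{_ : NonZero d}} → + n / d ≡ ℕ→ℚ n * 1/ℕ d
n/d≡n*1/d n (suc d) = trans
  (fromℚᵘ-*≡* (mkℚᵘ (+ n) d) (mkℚᵘ (+ n) 0 ℚᵘ.* mkℚᵘ (+ 1) d)
    (cong₂ ℤ._*_ (sym (ℤ.*-identityʳ (+ n))) (cong (λ x → + suc x) (ℕ.+-identityʳ d))))
  (fromℚᵘ-homo-* (mkℚᵘ (+ n) 0) (mkℚᵘ (+ 1) d))

1/ℕ-inverseʳ : ∀ d .{{_ : NonZero d}} → ℕ→ℚ d * 1/ℕ d ≡ 1ℚ
1/ℕ-inverseʳ (suc d) = trans (sym (fromℚᵘ-homo-* (mkℚᵘ (+ suc d) 0) (mkℚᵘ (+ 1) d)))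
  (fromℚᵘ-*≡* (mkℚᵘ (+ suc d) 0 ℚᵘ.* mkℚᵘ (+ 1) d) (mkℚᵘ (+ 1) 0)
    (trans (ℤ.*-identityʳ (+ suc d ℤ.* + 1)) (trans (ℤ.*-identityʳ (+ suc d))
      (sym (trans (ℤ.*-identityˡ _) (cong (λ x → + suc x) (ℕ.+-identityʳ d)))))))

1/ℕ-homo-* : ∀ a b .{{_ : NonZero a}} .{{_ : NonZero b}} → 1/ℕ (a ℕ.* b) {{ℕ.m*n≢0 a b}} ≡ 1/ℕ a * 1/ℕ b
1/ℕ-homo-* (suc a) (suc b) = trans
  (fromℚᵘ-*≡* (mkℚᵘ (+ 1) (b ℕ.+ a ℕ.* suc b)) (mkℚᵘ (+ 1) a ℚᵘ.* mkℚᵘ (+ 1) b) refl)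
  (fromℚᵘ-homo-* (mkℚᵘ (+ 1) a) (mkℚᵘ (+ 1) b))

-- Finite sums

Σ<-cong-< : ∀ n {f g : ℕ → ℚ} → (∀ {k} → k ℕ.< n → f k ≡ g k) → Σ< n f ≡ Σ< n g
Σ<-cong-< zero    eq = refl
Σ<-cong-< (suc n) eq = cong₂ _+_ (Σ<-cong-< n (eq ∘ ℕ.m<n⇒m<1+n)) (eq (ℕ.n<1+n n))

Σ<-cong : ∀ n {f g : ℕ → ℚ} → (∀ k → f k ≡ g k) → Σ< n f ≡ Σ< n g
Σ<-cong n eq = Σ<-cong-< n (λ {k} _ → eq k)

Σ<-zero : ∀ n → Σ< n (λ _ → 0ℚ) ≡ 0ℚ
Σ<-zero zero    = refl
Σ<-zero (suc n) = trans (ℚ.+-identityʳ _) (Σ<-zero n)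

Σ<-distrib-+ : ∀ n (f g : ℕ → ℚ) → Σ< n (λ k → f k + g k) ≡ Σ< n f + Σ< n g
Σ<-distrib-+ zero    f g = refl
Σ<-distrib-+ (suc n) f g = trans (cong (_+ (f n + g n)) (Σ<-distrib-+ n f g)) (interchange (Σ< n f) (Σ< n g) (f n) (g n))
  where
  interchange : ∀ a b c d → (a + b) + (c + d) ≡ (a + c) + (b + d)
  interchange = solve 4 (λ a b c d → (a :+ b) :+ (c :+ d) := (a :+ c) :+ (b :+ d)) refl

Σ<-distrib-- : ∀ n (f g : ℕ → ℚ) → Σ< n (λ k → f k - g k) ≡ Σ< n f - Σ< n g
Σ<-distrib-- zero    f g = refl
Σ<-distrib-- (suc n) f g = trans (cong (_+ (f n - g n)) (Σ<-distrib-- n f g)) (interchange (Σ< n f) (Σ< n g) (f n) (g n))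
  where
  interchange : ∀ a b c d → (a - b) + (c - d) ≡ (a + c) - (b + d)
  interchange = solve 4 (λ a b c d → (a :- b) :+ (c :- d) := (a :+ c) :- (b :+ d)) refl

*-distribˡ-Σ< : ∀ n c (f : ℕ → ℚ) → c * Σ< n f ≡ Σ< n (λ k → c * f k)
*-distribˡ-Σ< zero    c f = ℚ.*-zeroʳ c
*-distribˡ-Σ< (suc n) c f = trans (ℚ.*-distribˡ-+ c (Σ< n f) (f n)) (cong (_+ c * f n) (*-distribˡ-Σ< n c f))

Σ<-sucˡ : ∀ n (f : ℕ → ℚ) → Σ< (suc n) f ≡ f 0 + Σ< n (f ∘ suc)
Σ<-sucˡ zero    f = trans (ℚ.+-identityˡ (f 0)) (sym (ℚ.+-identityʳ (f 0)))
Σ<-sucˡ (suc n) f = trans (cong (_+ f (suc n)) (Σ<-sucˡ n f)) (ℚ.+-assoc (f 0) _ (f (suc n)))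

Σ<-shift : ∀ n (f : ℕ → ℚ) → f 0 ≡ 0ℚ → f n ≡ 0ℚ → Σ< n (f ∘ suc) ≡ Σ< n f
Σ<-shift n f f0≡0 fn≡0 = begin
  Σ< n (f ∘ suc)          ≡⟨ ℚ.+-identityˡ _ ⟨
  0ℚ + Σ< n (f ∘ suc)     ≡⟨ cong (_+ Σ< n (f ∘ suc)) f0≡0 ⟨
  f 0 + Σ< n (f ∘ suc)    ≡⟨ Σ<-sucˡ n f ⟨
  Σ< n f + f n            ≡⟨ cong (_+_ (Σ< n f)) fn≡0 ⟩
  Σ< n f + 0ℚ             ≡⟨ ℚ.+-identityʳ _ ⟩
  Σ< n f                  ∎
  where open ≡-Reasoning

Σ<-comm : ∀ m n (f : ℕ → ℕ → ℚ) → Σ< m (λ i → Σ< n (f i)) ≡ Σ< n (λ j → Σ< m (λ i → f i j))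
Σ<-comm zero    n f = sym (Σ<-zero n)
Σ<-comm (suc m) n f = trans (cong (_+ Σ< n (f m)) (Σ<-comm m n f)) (sym (Σ<-distrib-+ n _ (f m)))

Σ<-vanishing-tail : ∀ {m n} (f : ℕ → ℚ) → m ℕ.≤ n → (∀ {k} → m ℕ.≤ k → f k ≡ 0ℚ) → Σ< n f ≡ Σ< m f
Σ<-vanishing-tail {m} f m≤n f≡0 = go (ℕ.≤⇒≤′ m≤n)
  where
  go : ∀ {n} → m ℕ.≤′ n → Σ< n f ≡ Σ< m f
  go ℕ.≤′-refl        = refl
  go (ℕ.≤′-step m≤′n) = trans (cong₂ _+_ (go m≤′n) (f≡0 (ℕ.≤′⇒≤ m≤′n))) (ℚ.+-identityʳ _)

Σ<-telescope : ∀ n (f : ℕ → ℚ) → Σ< n (λ k → f k - f (suc k)) ≡ f 0 - f n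
Σ<-telescope zero    f = sym (ℚ.+-inverseʳ (f 0))
Σ<-telescope (suc n) f = trans (cong (_+ (f n - f (suc n))) (Σ<-telescope n f)) (cancel (f 0) (f n) (f (suc n)))
  where
  cancel : ∀ a b c → (a - b) + (b - c) ≡ a - c
  cancel = solve 3 (λ a b c → (a :- b) :+ (b :- c) := a :- c) refl

-- Stirling numbers of the second kind

stirling2-vanishing : ∀ {n k} → n ℕ.< k → stirling2 n k ≡ 0
stirling2-vanishing {zero}  {suc k} _ = refl
stirling2-vanishing {suc n} {suc k} (ℕ.s≤s n<k)
  rewrite stirling2-vanishing n<k | stirling2-vanishing (ℕ.m<n⇒m<1+n n<k) = ℕ.*-zeroʳ (suc k)

S : ℕ → ℕ → ℚ
S n k = ℕ→ℚ (stirling2 n k)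

S-suc : ∀ n k → S (suc n) (suc k)
                  ≡ S n k + ℕ→ℚ (suc k) * S n (suc k)
S-suc n k = trans (ℕ→ℚ-homo-+ (stirling2 n k) (suc k ℕ.* stirling2 n (suc k)))
  (cong (_+_ (S n k)) (ℕ→ℚ-homo-* (suc k) (stirling2 n (suc k))))

stirling2Transform : (ℕ → ℚ) → ℕ → ℚ
stirling2Transform c n = Σ≤ n (λ k → c k * S n k)

Σ-stirling2-recurrence : ∀ N (c : ℕ → ℚ) →
  Σ≤ N (λ k → c k * S (suc N) (suc k))
    ≡ stirling2Transform c N + Σ≤ N (λ k → c k * ℕ→ℚ (suc k) * S N (suc k))
Σ-stirling2-recurrence N c =
  trans (Σ<-cong (suc N) split) (Σ<-distrib-+ (suc N) (λ k → c k * S N k) (λ k → c k * ℕ→ℚ (suc k) * S N (suc k)))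
  where
  distribute : ∀ w a s b → w * (a + s * b) ≡ w * a + w * s * b
  distribute = solve 4 (λ w a s b → w :* (a :+ s :* b) := w :* a :+ w :* s :* b) refl
  split : ∀ k → c k * S (suc N) (suc k) ≡ c k * S N k + c k * ℕ→ℚ (suc k) * S N (suc k)
  split k = trans (cong (c k *_) (S-suc N k)) (distribute (c k) (S N k) (ℕ→ℚ (suc k)) (S N (suc k)))

stirling2Transform-suc : ∀ c n → stirling2Transform c (suc n) ≡ stirling2Transform (λ k → c (suc k) + c k * ℕ→ℚ k) n
stirling2Transform-suc c n = begin
  Σ< (suc (suc n)) (λ k → c k * S (suc n) k)
    ≡⟨ Σ<-sucˡ (suc n) (λ k → c k * S (suc n) k) ⟩
  c 0 * 0ℚ + Σ≤ n (λ k → c (suc k) * S (suc n) (suc k))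
    ≡⟨ trans (cong (_+ Σ≤ n (λ k → c (suc k) * S (suc n) (suc k))) (ℚ.*-zeroʳ (c 0))) (ℚ.+-identityˡ _) ⟩
  Σ≤ n (λ k → c (suc k) * S (suc n) (suc k))
    ≡⟨ Σ-stirling2-recurrence n (c ∘ suc) ⟩
  stirling2Transform (c ∘ suc) n + Σ≤ n (g ∘ suc)
    ≡⟨ cong (_+_ (stirling2Transform (c ∘ suc) n)) (Σ<-shift (suc n) g g0≡0 gn≡0) ⟩
  stirling2Transform (c ∘ suc) n + Σ≤ n g
    ≡⟨ Σ<-distrib-+ (suc n) (λ k → c (suc k) * S n k) g ⟨
  Σ≤ n (λ k → c (suc k) * S n k + c k * ℕ→ℚ k * S n k)
    ≡⟨ Σ<-cong (suc n) (λ k → ℚ.*-distribʳ-+ (S n k) (c (suc k)) (c k * ℕ→ℚ k)) ⟨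
  stirling2Transform (λ k → c (suc k) + c k * ℕ→ℚ k) n ∎
  where
  open ≡-Reasoning
  g : ℕ → ℚ
  g k = c k * ℕ→ℚ k * S n k
  g0≡0 : g 0 ≡ 0ℚ
  g0≡0 = trans (cong (_* S n 0) (ℚ.*-zeroʳ (c 0))) (ℚ.*-zeroˡ (S n 0))
  gn≡0 : g (suc n) ≡ 0ℚ
  gn≡0 = trans (cong (λ s → c (suc n) * ℕ→ℚ (suc n) * ℕ→ℚ s) (stirling2-vanishing (ℕ.n<1+n n)))
               (ℚ.*-zeroʳ (c (suc n) * ℕ→ℚ (suc n)))

stirling2Transform-linear : ∀ a (f g : ℕ → ℚ) n →
  stirling2Transform (λ k → a * (f k - g k)) n ≡ a * (stirling2Transform f n - stirling2Transform g n)
stirling2Transform-linear a f g n = begin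
  Σ≤ n (λ k → a * (f k - g k) * S n k)
    ≡⟨ Σ<-cong (suc n) (λ k → distribute a (f k) (g k) (S n k)) ⟩
  Σ≤ n (λ k → a * (f k * S n k - g k * S n k))
    ≡⟨ *-distribˡ-Σ< (suc n) a (λ k → f k * S n k - g k * S n k) ⟨
  a * Σ≤ n (λ k → f k * S n k - g k * S n k)
    ≡⟨ cong (a *_) (Σ<-distrib-- (suc n) (λ k → f k * S n k) (λ k → g k * S n k)) ⟩
  a * (stirling2Transform f n - stirling2Transform g n) ∎
  where
  open ≡-Reasoning
  distribute : ∀ a u v s → a * (u - v) * s ≡ a * (u * s - v * s)
  distribute = solve 4 (λ a u v s → a :* (u :- v) :* s := a :* (u :* s :- v :* s)) refl

Σ-alternating-stirling2 : ∀ {M K} → M ℕ.< K →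
  Σ< K (λ k → signPow k * ℕ→ℚ (k !) * S (suc M) (suc k)) ≡ S M 0
Σ-alternating-stirling2 {M} {K} M<K = begin
  Σ< K (λ k → signPow k * ℕ→ℚ (k !) * S (suc M) (suc k))
    ≡⟨ Σ<-cong K difference ⟩
  Σ< K (λ k → f k - f (suc k))
    ≡⟨ Σ<-telescope K f ⟩
  f 0 - f K
    ≡⟨ cong (λ x → f 0 - x) (trans (cong (λ s → signPow K * ℕ→ℚ (K !) * ℕ→ℚ s) (stirling2-vanishing M<K))
                                   (ℚ.*-zeroʳ (signPow K * ℕ→ℚ (K !)))) ⟩
  f 0 - 0ℚ
    ≡⟨ simplify (S M 0) ⟩
  S M 0 ∎
  where
  open ≡-Reasoning
  f : ℕ → ℚ
  f k = signPow k * ℕ→ℚ (k !) * S M k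
  split : ∀ s F a c b → s * F * (a + c * b) ≡ s * F * a - (- s) * (c * F) * b
  split = solve 5 (λ s F a c b → s :* F :* (a :+ c :* b) := s :* F :* a :- (:- s) :* (c :* F) :* b) refl
  difference : ∀ k → signPow k * ℕ→ℚ (k !) * S (suc M) (suc k) ≡ f k - f (suc k)
  difference k = begin
    signPow k * ℕ→ℚ (k !) * S (suc M) (suc k)
      ≡⟨ cong (signPow k * ℕ→ℚ (k !) *_) (S-suc M k) ⟩
    signPow k * ℕ→ℚ (k !) * (S M k + ℕ→ℚ (suc k) * S M (suc k))
      ≡⟨ split (signPow k) (ℕ→ℚ (k !)) (S M k) (ℕ→ℚ (suc k)) (S M (suc k)) ⟩
    f k - (- signPow k) * (ℕ→ℚ (suc k) * ℕ→ℚ (k !)) * S M (suc k)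
      ≡⟨ cong (λ x → f k - (- signPow k) * x * S M (suc k)) (ℕ→ℚ-homo-* (suc k) (k !)) ⟨
    f k - f (suc k) ∎
  simplify : ∀ x → 1ℚ * 1ℚ * x - 0ℚ ≡ x
  simplify = solve 1 (λ x → (con 1ℚ) :* (con 1ℚ) :* x :- (con 0ℚ) := x) refl

ℕ→ℚ-pascal : ∀ n k → ℕ→ℚ (suc n C suc k) ≡ ℕ→ℚ (n C k) + ℕ→ℚ (n C suc k)
ℕ→ℚ-pascal n k = trans (cong ℕ→ℚ (sym (nCk+nC[k+1]≡[n+1]C[k+1] n k))) (ℕ→ℚ-homo-+ (n C k) (n C suc k))

Σ-binomial-suc : ∀ N (f : ℕ → ℚ) →
  Σ≤ (suc N) (λ j → ℕ→ℚ (suc N C j) * f j)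
    ≡ Σ≤ N (λ j → ℕ→ℚ (N C j) * f j) + Σ≤ N (λ j → ℕ→ℚ (N C j) * f (suc j))
Σ-binomial-suc N f = begin
  Σ≤ (suc N) (λ j → ℕ→ℚ (suc N C j) * f j)
    ≡⟨ Σ<-sucˡ (suc N) (λ j → ℕ→ℚ (suc N C j) * f j) ⟩
  g 0 + Σ≤ N (λ j → ℕ→ℚ (suc N C suc j) * f (suc j))
    ≡⟨ cong (_+_ (g 0)) (trans (Σ<-cong (suc N) pascal) (Σ<-distrib-+ (suc N) h (g ∘ suc))) ⟩
  g 0 + (Σ≤ N h + Σ≤ N (g ∘ suc))
    ≡⟨ rearrange (g 0) (Σ≤ N h) (Σ≤ N (g ∘ suc)) ⟩
  (g 0 + Σ≤ N (g ∘ suc)) + Σ≤ N h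
    ≡⟨ cong (_+ Σ≤ N h) (Σ<-sucˡ (suc N) g) ⟨
  (Σ≤ N g + g (suc N)) + Σ≤ N h
    ≡⟨ cong (λ x → (Σ≤ N g + x) + Σ≤ N h) g[N+1]≡0 ⟩
  (Σ≤ N g + 0ℚ) + Σ≤ N h
    ≡⟨ cong (_+ Σ≤ N h) (ℚ.+-identityʳ (Σ≤ N g)) ⟩
  Σ≤ N g + Σ≤ N h ∎
  where
  open ≡-Reasoning
  g h : ℕ → ℚ
  g j = ℕ→ℚ (N C j) * f j
  h j = ℕ→ℚ (N C j) * f (suc j)
  pascal : ∀ j → ℕ→ℚ (suc N C suc j) * f (suc j) ≡ h j + g (suc j)
  pascal j = trans (cong (_* f (suc j)) (ℕ→ℚ-pascal N j)) (ℚ.*-distribʳ-+ (f (suc j)) (ℕ→ℚ (N C j)) (ℕ→ℚ (N C suc j)))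
  rearrange : ∀ a b c → a + (b + c) ≡ (a + c) + b
  rearrange = solve 3 (λ a b c → a :+ (b :+ c) := (a :+ c) :+ b) refl
  g[N+1]≡0 : g (suc N) ≡ 0ℚ
  g[N+1]≡0 = trans (cong (λ x → ℕ→ℚ x * f (suc N)) (k>n⇒nCk≡0 (ℕ.n<1+n N))) (ℚ.*-zeroˡ (f (suc N)))

Σ-binomial-stirling2 : ∀ N k →
  Σ≤ N (λ j → ℕ→ℚ (N C j) * S j k) ≡ S (suc N) (suc k)

Σ-binomial-stirling2-suc : ∀ N k →
  Σ≤ N (λ j → ℕ→ℚ (N C j) * S (suc j) k)
    ≡ S (suc N) k + ℕ→ℚ k * S (suc N) (suc k)

Σ-binomial-stirling2 zero k =
  trans (simplify (S 0 k) (ℕ→ℚ (suc k))) (sym (S-suc 0 k))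
  where
  simplify : ∀ x c → 0ℚ + 1ℚ * x ≡ x + c * 0ℚ
  simplify = solve 2 (λ x c → (con 0ℚ) :+ (con 1ℚ) :* x := x :+ c :* (con 0ℚ)) refl
Σ-binomial-stirling2 (suc N) k = begin
  Σ≤ (suc N) (λ j → ℕ→ℚ (suc N C j) * S j k)
    ≡⟨ Σ-binomial-suc N (λ j → S j k) ⟩
  Σ≤ N (λ j → ℕ→ℚ (N C j) * S j k) + Σ≤ N (λ j → ℕ→ℚ (N C j) * S (suc j) k)
    ≡⟨ cong₂ _+_ (Σ-binomial-stirling2 N k) (Σ-binomial-stirling2-suc N k) ⟩
  S (suc N) (suc k) + (S (suc N) k + ℕ→ℚ k * S (suc N) (suc k))
    ≡⟨ collect (S (suc N) (suc k)) (S (suc N) k) (ℕ→ℚ k) ⟩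
  S (suc N) k + (1ℚ + ℕ→ℚ k) * S (suc N) (suc k)
    ≡⟨ cong (λ c → S (suc N) k + c * S (suc N) (suc k)) (ℕ→ℚ-homo-+ 1 k) ⟨
  S (suc N) k + ℕ→ℚ (suc k) * S (suc N) (suc k)
    ≡⟨ S-suc (suc N) k ⟨
  S (suc (suc N)) (suc k) ∎
  where
  open ≡-Reasoning
  collect : ∀ a b c → a + (b + c * a) ≡ b + (1ℚ + c) * a
  collect = solve 3 (λ a b c → a :+ (b :+ c :* a) := b :+ ((con 1ℚ) :+ c) :* a) refl

Σ-binomial-stirling2-suc N zero =
  trans (Σ<-cong (suc N) (λ j → ℚ.*-zeroʳ (ℕ→ℚ (N C j))))
        (trans (Σ<-zero (suc N)) (simplify (S (suc N) 1)))
  where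
  simplify : ∀ x → 0ℚ ≡ 0ℚ + 0ℚ * x
  simplify = solve 1 (λ x → (con 0ℚ) := (con 0ℚ) :+ (con 0ℚ) :* x) refl
Σ-binomial-stirling2-suc N (suc k) = begin
  Σ≤ N (λ j → choose j * S (suc j) (suc k))
    ≡⟨ Σ<-cong (suc N) (λ j → trans (cong (choose j *_) (S-suc j k))
                                    (distribute (choose j) (S j k) (ℕ→ℚ (suc k)) (S j (suc k)))) ⟩
  Σ≤ N (λ j → choose j * S j k + ℕ→ℚ (suc k) * (choose j * S j (suc k)))
    ≡⟨ Σ<-distrib-+ (suc N) (λ j → choose j * S j k) (λ j → ℕ→ℚ (suc k) * (choose j * S j (suc k))) ⟩
  Σ≤ N (λ j → choose j * S j k) + Σ≤ N (λ j → ℕ→ℚ (suc k) * (choose j * S j (suc k)))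
    ≡⟨ cong (_+_ (Σ≤ N (λ j → choose j * S j k)))
            (*-distribˡ-Σ< (suc N) (ℕ→ℚ (suc k)) (λ j → choose j * S j (suc k))) ⟨
  Σ≤ N (λ j → choose j * S j k) + ℕ→ℚ (suc k) * Σ≤ N (λ j → choose j * S j (suc k))
    ≡⟨ cong₂ (λ x y → x + ℕ→ℚ (suc k) * y) (Σ-binomial-stirling2 N k) (Σ-binomial-stirling2 N (suc k)) ⟩
  S (suc N) (suc k) + ℕ→ℚ (suc k) * S (suc N) (suc (suc k)) ∎
  where
  open ≡-Reasoning
  choose : ℕ → ℚ
  choose j = ℕ→ℚ (N C j)
  distribute : ∀ c a s b → c * (a + s * b) ≡ c * a + s * (c * b)
  distribute = solve 4 (λ c a s b → c :* (a :+ s :* b) := c :* a :+ s :* (c :* b)) refl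

Σ-binomial-stirling2Transform : ∀ N (c : ℕ → ℚ) →
  Σ≤ N (λ j → ℕ→ℚ (N C j) * stirling2Transform c j) ≡ Σ≤ N (λ k → c k * S (suc N) (suc k))
Σ-binomial-stirling2Transform N c = begin
  Σ≤ N (λ j → choose j * Σ≤ j (term j))
    ≡⟨ Σ<-cong-< (suc N) (λ {j} j<1+N → cong (choose j *_) (Σ<-vanishing-tail (term j) j<1+N (vanishing j))) ⟨
  Σ≤ N (λ j → choose j * Σ≤ N (term j))
    ≡⟨ Σ<-cong (suc N) (λ j → *-distribˡ-Σ< (suc N) (choose j) (term j)) ⟩
  Σ≤ N (λ j → Σ≤ N (λ k → choose j * term j k))
    ≡⟨ Σ<-comm (suc N) (suc N) (λ j k → choose j * term j k) ⟩
  Σ≤ N (λ k → Σ≤ N (λ j → choose j * term j k))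
    ≡⟨ Σ<-cong (suc N) (λ k → trans (Σ<-cong (suc N) (λ j → swap (choose j) (c k) (S j k)))
                                    (sym (*-distribˡ-Σ< (suc N) (c k) (λ j → choose j * S j k)))) ⟩
  Σ≤ N (λ k → c k * Σ≤ N (λ j → choose j * S j k))
    ≡⟨ Σ<-cong (suc N) (λ k → cong (c k *_) (Σ-binomial-stirling2 N k)) ⟩
  Σ≤ N (λ k → c k * S (suc N) (suc k)) ∎
  where
  open ≡-Reasoning
  choose : ℕ → ℚ
  choose j = ℕ→ℚ (N C j)
  term : ℕ → ℕ → ℚ
  term j k = c k * S j k
  vanishing : ∀ j {k} → j ℕ.< k → term j k ≡ 0ℚ
  vanishing j {k} j<k = trans (cong (λ s → c k * ℕ→ℚ s) (stirling2-vanishing j<k)) (ℚ.*-zeroʳ (c k))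
  swap : ∀ a b x → a * (b * x) ≡ b * (a * x)
  swap = solve 3 (λ a b x → a :* (b :* x) := b :* (a :* x)) refl

-- Bernoulli numbers

tabulate-∷ʳ : ∀ {a} {A : Set a} n (g : ℕ → A) → tabulate {n = suc n} (g ∘ toℕ) ≡ tabulate (g ∘ toℕ) ∷ʳ g n
tabulate-∷ʳ zero    g = refl
tabulate-∷ʳ (suc n) g = cong (g 0 ∷_) (tabulate-∷ʳ n (g ∘ suc))

zipWith-tabulate : ∀ {a b c} {A : Set a} {B : Set b} {C : Set c} {n} (f : A → B → C) (g : Fin n → A) (h : Fin n → B) →
                   zipWith f (tabulate g) (tabulate h) ≡ tabulate (λ i → f (g i) (h i))
zipWith-tabulate {n = zero}  f g h = refl
zipWith-tabulate {n = suc n} f g h = cong (f (g Fin.zero) (h Fin.zero) ∷_) (zipWith-tabulate f (g ∘ Fin.suc) (h ∘ Fin.suc))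
  where import Data.Fin as Fin

foldr-+-tabulate : ∀ n (f : ℕ → ℚ) → foldr (λ _ → ℚ) _+_ 0ℚ (tabulate {n = n} (f ∘ toℕ)) ≡ Σ< n f
foldr-+-tabulate zero    f = refl
foldr-+-tabulate (suc n) f = trans (cong (_+_ (f 0)) (foldr-+-tabulate n (f ∘ suc))) (sym (Σ<-sucˡ n f))

bernoulliVec≡tabulate : ∀ m → bernoulliVec m ≡ tabulate (bernoulli ∘ toℕ)
bernoulliVec≡tabulate zero    = refl
bernoulliVec≡tabulate (suc m) = trans (cong₂ _∷ʳ_ (bernoulliVec≡tabulate m) (sym (last-∷ʳ _ (bernoulliVec m))))
                                      (sym (tabulate-∷ʳ (suc m) bernoulli))

bernoulli-suc : ∀ m → bernoulli (suc m) ≡ - (Σ< (suc m) (λ k → ℕ→ℚ (suc (suc m) C k) * bernoulli k) * 1/ℕ (suc (suc m)))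
bernoulli-suc m = trans (last-∷ʳ _ (bernoulliVec m)) (cong (λ x → - (x * 1/ℕ (suc (suc m)))) (begin
  sum (zipWith weighted (allFin (suc m)) (bernoulliVec m))
    ≡⟨ cong (sum ∘ zipWith weighted (allFin (suc m))) (bernoulliVec≡tabulate m) ⟩
  sum (zipWith weighted (allFin (suc m)) (tabulate (bernoulli ∘ toℕ)))
    ≡⟨ cong sum (zipWith-tabulate weighted id (bernoulli ∘ toℕ)) ⟩
  sum (tabulate (λ i → ℕ→ℚ (suc (suc m) C toℕ i) * bernoulli (toℕ i)))
    ≡⟨ foldr-+-tabulate (suc m) (λ k → ℕ→ℚ (suc (suc m) C k) * bernoulli k) ⟩
  Σ< (suc m) (λ k → ℕ→ℚ (suc (suc m) C k) * bernoulli k) ∎))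
  where
  open ≡-Reasoning
  sum : Vec ℚ (suc m) → ℚ
  sum = foldr (λ _ → ℚ) _+_ 0ℚ
  weighted : Fin (suc m) → ℚ → ℚ
  weighted i b = ℕ→ℚ (suc (suc m) C toℕ i) * b

[1+n]Cn≡1+n : ∀ n → suc n C n ≡ suc n
[1+n]Cn≡1+n n = trans (nCk≡nC[n∸k] (ℕ.n≤1+n n)) (trans (cong (suc n C_) (ℕ.m+n∸n≡m 1 n)) (nC1≡n (suc n)))

bernoulli-unique : ∀ (f : ℕ → ℚ) → f 0 ≡ 1ℚ →
  (∀ m → Σ< (suc (suc m)) (λ k → ℕ→ℚ (suc (suc m) C k) * f k) ≡ 0ℚ) → ∀ n → f n ≡ bernoulli n
bernoulli-unique f f0≡1 recurrence = <-rec (λ n → f n ≡ bernoulli n) step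
  where
  step : ∀ n → (∀ {k} → k ℕ.< n → f k ≡ bernoulli k) → f n ≡ bernoulli n
  step zero    _  = f0≡1
  step (suc m) ih = begin
    f (suc m)                                ≡⟨ solve-linear (Σ< (suc m) (binomial f)) last-term ⟩
    - (Σ< (suc m) (binomial f) * i)          ≡⟨ cong (λ x → - (x * i)) (Σ<-cong-< (suc m) (λ {k} → cong (binomial-coefficient k *_) ∘ ih)) ⟩
    - (Σ< (suc m) (binomial bernoulli) * i)  ≡⟨ bernoulli-suc m ⟨
    bernoulli (suc m)                        ∎
    where
    open ≡-Reasoning
    N : ℕ
    N = suc (suc m)
    i : ℚ
    i = 1/ℕ N
    binomial-coefficient : ℕ → ℚ
    binomial-coefficient k = ℕ→ℚ (N C k)
    binomial : (ℕ → ℚ) → ℕ → ℚ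
    binomial g k = binomial-coefficient k * g k
    last-term : Σ< (suc m) (binomial f) + ℕ→ℚ N * f (suc m) ≡ 0ℚ
    last-term = trans (cong (λ c → Σ< (suc m) (binomial f) + ℕ→ℚ c * f (suc m)) (sym ([1+n]Cn≡1+n (suc m))))
                      (recurrence m)
    solve-linear : ∀ P {x} → P + ℕ→ℚ N * x ≡ 0ℚ → x ≡ - (P * i)
    solve-linear P {x} P+Nx≡0 = begin
      x                                ≡⟨ ℚ.*-identityʳ x ⟨
      x * 1ℚ                           ≡⟨ cong (x *_) (1/ℕ-inverseʳ N) ⟨
      x * (ℕ→ℚ N * i)                  ≡⟨ expand P (ℕ→ℚ N) x i ⟩
      - (P * i) + (P + ℕ→ℚ N * x) * i  ≡⟨ cong (λ t → - (P * i) + t * i) P+Nx≡0 ⟩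
      - (P * i) + 0ℚ * i               ≡⟨ cancel (- (P * i)) i ⟩
      - (P * i)                        ∎
      where
      expand : ∀ P c x i → x * (c * i) ≡ - (P * i) + (P + c * x) * i
      expand = solve 4 (λ P c x i → x :* (c :* i) := :- (P :* i) :+ (P :+ c :* x) :* i) refl
      cancel : ∀ a i → a + 0ℚ * i ≡ a
      cancel = solve 2 (λ a i → a :+ (con 0ℚ) :* i := a) refl

-- The alternating factorial weights

weight : ℕ → ℕ → ℚ
weight m k = signPow k * (+ (k !) / (suc m ℕ.+ k))

weight-zero-*-suc : ∀ k → weight 0 k * ℕ→ℚ (suc k) ≡ signPow k * ℕ→ℚ (k !)
weight-zero-*-suc k = begin
  signPow k * (+ (k !) / suc k) * ℕ→ℚ (suc k)
    ≡⟨ cong (λ x → signPow k * x * ℕ→ℚ (suc k)) (n/d≡n*1/d (k !) (suc k)) ⟩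
  signPow k * (ℕ→ℚ (k !) * 1/ℕ (suc k)) * ℕ→ℚ (suc k)
    ≡⟨ reassociate (signPow k) (ℕ→ℚ (k !)) (1/ℕ (suc k)) (ℕ→ℚ (suc k)) ⟩
  signPow k * ℕ→ℚ (k !) * (ℕ→ℚ (suc k) * 1/ℕ (suc k))
    ≡⟨ cong (signPow k * ℕ→ℚ (k !) *_) (1/ℕ-inverseʳ (suc k)) ⟩
  signPow k * ℕ→ℚ (k !) * 1ℚ
    ≡⟨ ℚ.*-identityʳ (signPow k * ℕ→ℚ (k !)) ⟩
  signPow k * ℕ→ℚ (k !) ∎
  where
  open ≡-Reasoning
  reassociate : ∀ s F i d → s * (F * i) * d ≡ s * F * (d * i)
  reassociate = solve 4 (λ s F i d → s :* (F :* i) :* d := s :* F :* (d :* i)) refl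

stirling2Transform-weight-zero≡bernoulli : ∀ n → stirling2Transform (weight 0) n ≡ bernoulli n
stirling2Transform-weight-zero≡bernoulli = bernoulli-unique T refl recurrence
  where
  T : ℕ → ℚ
  T = stirling2Transform (weight 0)
  cancel : ∀ x t → x + 1ℚ * t ≡ t → x ≡ 0ℚ
  cancel x t eq = begin
    x                    ≡⟨ expand x t ⟩
    (x + 1ℚ * t) - t     ≡⟨ cong (_- t) eq ⟩
    t - t                ≡⟨ ℚ.+-inverseʳ t ⟩
    0ℚ                   ∎
    where
    open ≡-Reasoning
    expand : ∀ x t → x ≡ (x + 1ℚ * t) - t
    expand = solve 2 (λ x t → x := (x :+ (con 1ℚ) :* t) :- t) refl
  recurrence : ∀ m → Σ< (suc (suc m)) (λ k → ℕ→ℚ (suc (suc m) C k) * T k) ≡ 0ℚ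
  recurrence m = cancel (Σ< N (λ j → ℕ→ℚ (N C j) * T j)) (T N) (begin
    Σ< N (λ j → ℕ→ℚ (N C j) * T j) + 1ℚ * T N
      ≡⟨ cong (λ c → Σ< N (λ j → ℕ→ℚ (N C j) * T j) + ℕ→ℚ c * T N) (nCn≡1 N) ⟨
    Σ≤ N (λ j → ℕ→ℚ (N C j) * T j)
      ≡⟨ Σ-binomial-stirling2Transform N (weight 0) ⟩
    Σ≤ N (λ k → weight 0 k * S (suc N) (suc k))
      ≡⟨ Σ-stirling2-recurrence N (weight 0) ⟩
    T N + Σ≤ N (λ k → weight 0 k * ℕ→ℚ (suc k) * S N (suc k))
      ≡⟨ cong (_+_ (T N)) (Σ<-cong (suc N) (λ k → cong (_* S N (suc k)) (weight-zero-*-suc k))) ⟩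
    T N + Σ≤ N (λ k → signPow k * ℕ→ℚ (k !) * S N (suc k))
      ≡⟨ cong (_+_ (T N)) (Σ-alternating-stirling2 (ℕ.m<n⇒m<1+n (ℕ.n<1+n (suc m)))) ⟩
    T N + 0ℚ
      ≡⟨ ℚ.+-identityʳ (T N) ⟩
    T N ∎)
    where
    open ≡-Reasoning
    N : ℕ
    N = suc (suc m)

-- For x = 1/(r+K) and y = 1/(r+K+1) this is -(K+1)y + Kx = r(y - x), scaled by sF.
partial-fractions : ∀ s F K r x y → (r + K) * x ≡ 1ℚ → (1ℚ + (r + K)) * y ≡ 1ℚ →
                    (- s) * ((1ℚ + K) * F * y) + s * (F * x) * K ≡ r * (s * (F * y) - s * (F * x))
partial-fractions s F K r x y [r+K]x≡1 [1+r+K]y≡1 = begin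
  (- s) * ((1ℚ + K) * F * y) + s * (F * x) * K
    ≡⟨ expand s F K r x y ⟩
  r * (s * (F * y) - s * (F * x)) + s * F * ((r + K) * x - (1ℚ + (r + K)) * y)
    ≡⟨ cong₂ (λ u v → r * (s * (F * y) - s * (F * x)) + s * F * (u - v)) [r+K]x≡1 [1+r+K]y≡1 ⟩
  r * (s * (F * y) - s * (F * x)) + s * F * (1ℚ - 1ℚ)
    ≡⟨ cancel (r * (s * (F * y) - s * (F * x))) (s * F) ⟩
  r * (s * (F * y) - s * (F * x)) ∎
  where
  open ≡-Reasoning
  expand : ∀ s F K r x y → (- s) * ((1ℚ + K) * F * y) + s * (F * x) * K
                         ≡ r * (s * (F * y) - s * (F * x)) + s * F * ((r + K) * x - (1ℚ + (r + K)) * y)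
  expand = solve 6 (λ s F K r x y → (:- s) :* (((con 1ℚ) :+ K) :* F :* y) :+ s :* (F :* x) :* K
                                 := r :* (s :* (F :* y) :- s :* (F :* x)) :+ s :* F :* ((r :+ K) :* x :- ((con 1ℚ) :+ (r :+ K)) :* y)) refl
  cancel : ∀ a b → a + b * (1ℚ - 1ℚ) ≡ a
  cancel = solve 2 (λ a b → a :+ b :* ((con 1ℚ) :- (con 1ℚ)) := a) refl

weight-suc : ∀ m k → weight m (suc k) + weight m k * ℕ→ℚ k ≡ ℕ→ℚ (suc m) * (weight (suc m) k - weight m k)
weight-suc m k = begin
  weight m (suc k) + weight m k * K
    ≡⟨ cong₂ (λ u v → u + v * K) weight-m-[1+k] weight-m-k ⟩
  (- s) * ((1ℚ + K) * F * y) + s * (F * x) * K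
    ≡⟨ partial-fractions s F K r x y
         (inverse (suc m ℕ.+ k) (ℕ→ℚ-homo-+ (suc m) k))
         (inverse (suc (suc m) ℕ.+ k) (trans (ℕ→ℚ-homo-+ 1 (suc m ℕ.+ k)) (cong (_+_ 1ℚ) (ℕ→ℚ-homo-+ (suc m) k)))) ⟩
  r * (s * (F * y) - s * (F * x))
    ≡⟨ cong₂ (λ u v → r * (u - v)) weight-[1+m]-k weight-m-k ⟨
  r * (weight (suc m) k - weight m k) ∎
  where
  open ≡-Reasoning
  s F K r x y : ℚ
  s = signPow k
  F = ℕ→ℚ (k !)
  K = ℕ→ℚ k
  r = ℕ→ℚ (suc m)
  x = 1/ℕ (suc m ℕ.+ k)
  y = 1/ℕ (suc (suc m) ℕ.+ k)
  inverse : ∀ d .{{_ : NonZero d}} {a} → ℕ→ℚ d ≡ a → a * 1/ℕ d ≡ 1ℚ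
  inverse d refl = 1/ℕ-inverseʳ d
  weight-m-k : weight m k ≡ s * (F * x)
  weight-m-k = cong (s *_) (n/d≡n*1/d (k !) (suc m ℕ.+ k))
  weight-[1+m]-k : weight (suc m) k ≡ s * (F * y)
  weight-[1+m]-k = cong (s *_) (n/d≡n*1/d (k !) (suc (suc m) ℕ.+ k))
  weight-m-[1+k] : weight m (suc k) ≡ (- s) * ((1ℚ + K) * F * y)
  weight-m-[1+k] = cong ((- s) *_) (begin
    + (suc k ℕ.* k !) / (suc m ℕ.+ suc k)
      ≡⟨ n/d≡n*1/d (suc k ℕ.* k !) (suc m ℕ.+ suc k) ⟩
    ℕ→ℚ (suc k ℕ.* k !) * 1/ℕ (suc m ℕ.+ suc k)
      ≡⟨ cong₂ _*_ (trans (ℕ→ℚ-homo-* (suc k) (k !)) (cong (_* F) (ℕ→ℚ-homo-+ 1 k)))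
                   (cong (λ d → 1/ℕ (suc d)) (ℕ.+-suc m k)) ⟩
    (1ℚ + K) * F * y ∎)

stirling2Transform-weight-suc : ∀ m n →
  stirling2Transform (weight (suc m)) n
    ≡ stirling2Transform (weight m) n + stirling2Transform (weight m) (suc n) * 1/ℕ (suc m)
stirling2Transform-weight-suc m n = solve-for (ℕ→ℚ (suc m)) (1/ℕ (suc m)) (1/ℕ-inverseʳ (suc m)) (begin
  stirling2Transform (weight m) (suc n)
    ≡⟨ stirling2Transform-suc (weight m) n ⟩
  stirling2Transform (λ k → weight m (suc k) + weight m k * ℕ→ℚ k) n
    ≡⟨ Σ<-cong (suc n) (λ k → cong (_* S n k) (weight-suc m k)) ⟩
  stirling2Transform (λ k → ℕ→ℚ (suc m) * (weight (suc m) k - weight m k)) n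
    ≡⟨ stirling2Transform-linear (ℕ→ℚ (suc m)) (weight (suc m)) (weight m) n ⟩
  ℕ→ℚ (suc m) * (stirling2Transform (weight (suc m)) n - stirling2Transform (weight m) n) ∎)
  where
  open ≡-Reasoning
  solve-for : ∀ r i {x y z} → r * i ≡ 1ℚ → x ≡ r * (y - z) → y ≡ z + x * i
  solve-for r i {y = y} {z} r*i≡1 refl = begin
    y                       ≡⟨ expand y z ⟩
    z + (y - z) * 1ℚ        ≡⟨ cong (λ t → z + (y - z) * t) r*i≡1 ⟨
    z + (y - z) * (r * i)   ≡⟨ reassociate r i y z ⟩
    z + r * (y - z) * i     ∎
    where
    expand : ∀ y z → y ≡ z + (y - z) * 1ℚ
    expand = solve 2 (λ y z → y := z :+ (y :- z) :* (con 1ℚ)) refl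
    reassociate : ∀ r i y z → z + (y - z) * (r * i) ≡ z + r * (y - z) * i
    reassociate = solve 4 (λ r i y z → z :+ (y :- z) :* (r :* i) := z :+ r :* (y :- z) :* i) refl

-- Stirling numbers of the first kind

unsignedStirling1 : ℕ → ℕ → ℕ
unsignedStirling1 zero    zero    = 1
unsignedStirling1 zero    (suc k) = 0
unsignedStirling1 (suc n) zero    = 0
unsignedStirling1 (suc n) (suc k) = unsignedStirling1 n k ℕ.+ n ℕ.* unsignedStirling1 n (suc k)

stirling1≡±unsignedStirling1 : ∀ n k → stirling1 n k ≡ -1ℤ ^ (n ℕ.+ k) ℤ.* + unsignedStirling1 n k
stirling1≡±unsignedStirling1 zero    zero    = refl
stirling1≡±unsignedStirling1 zero    (suc k) = sym (ℤ.*-zeroʳ (-1ℤ ^ suc k))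
stirling1≡±unsignedStirling1 (suc n) zero    = sym (ℤ.*-zeroʳ (-1ℤ ^ (suc n ℕ.+ 0)))
stirling1≡±unsignedStirling1 (suc n) (suc k) = begin
  stirling1 n k ℤ.- + n ℤ.* stirling1 n (suc k)
    ≡⟨ cong₂ (λ u v → u ℤ.- + n ℤ.* v) (stirling1≡±unsignedStirling1 n k)
             (trans (stirling1≡±unsignedStirling1 n (suc k)) (cong (λ j → -1ℤ ^ j ℤ.* + b) (ℕ.+-suc n k))) ⟩
  ε ℤ.* + a ℤ.- + n ℤ.* (-1ℤ ℤ.* ε ℤ.* + b)
    ≡⟨ regroup ε (+ a) (+ b) (+ n) ⟩
  -1ℤ ℤ.* (-1ℤ ℤ.* ε) ℤ.* (+ a ℤ.+ + n ℤ.* + b)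
    ≡⟨ cong₂ (λ j c → -1ℤ ℤ.* -1ℤ ^ j ℤ.* c) (ℕ.+-suc n k)
             (trans (ℤ.pos-+ a (n ℕ.* b)) (cong (ℤ._+_ (+ a)) (ℤ.pos-* n b))) ⟨
  -1ℤ ^ (suc n ℕ.+ suc k) ℤ.* + (a ℕ.+ n ℕ.* b) ∎
  where
  open ≡-Reasoning
  a b : ℕ
  a = unsignedStirling1 n k
  b = unsignedStirling1 n (suc k)
  ε : ℤ
  ε = -1ℤ ^ (n ℕ.+ k)
  regroup : ∀ e x y z → e ℤ.* x ℤ.- z ℤ.* (-1ℤ ℤ.* e ℤ.* y) ≡ -1ℤ ℤ.* (-1ℤ ℤ.* e) ℤ.* (x ℤ.+ z ℤ.* y)
  regroup = ℤ-Solver.solve-∀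

∣-1ℤ^n∣≡1 : ∀ n → ∣ -1ℤ ^ n ∣ ≡ 1
∣-1ℤ^n∣≡1 zero    = refl
∣-1ℤ^n∣≡1 (suc n) = trans (ℤ.abs-* -1ℤ (-1ℤ ^ n)) (trans (ℕ.+-identityʳ _) (∣-1ℤ^n∣≡1 n))

∣stirling1∣≡unsignedStirling1 : ∀ n k → ∣ stirling1 n k ∣ ≡ unsignedStirling1 n k
∣stirling1∣≡unsignedStirling1 n k = begin
  ∣ stirling1 n k ∣                                            ≡⟨ cong ∣_∣ (stirling1≡±unsignedStirling1 n k) ⟩
  ∣ -1ℤ ^ (n ℕ.+ k) ℤ.* + unsignedStirling1 n k ∣               ≡⟨ ℤ.abs-* (-1ℤ ^ (n ℕ.+ k)) (+ unsignedStirling1 n k) ⟩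
  ∣ -1ℤ ^ (n ℕ.+ k) ∣ ℕ.* unsignedStirling1 n k                 ≡⟨ cong (ℕ._* unsignedStirling1 n k) (∣-1ℤ^n∣≡1 (n ℕ.+ k)) ⟩
  1 ℕ.* unsignedStirling1 n k                                   ≡⟨ ℕ.*-identityˡ (unsignedStirling1 n k) ⟩
  unsignedStirling1 n k                                          ∎
  where open ≡-Reasoning

unsignedStirling1-vanishing : ∀ {n k} → n ℕ.< k → unsignedStirling1 n k ≡ 0
unsignedStirling1-vanishing {zero}  {suc k} _ = refl
unsignedStirling1-vanishing {suc n} {suc k} (ℕ.s≤s n<k)
  rewrite unsignedStirling1-vanishing n<k | unsignedStirling1-vanishing (ℕ.m<n⇒m<1+n n<k) = ℕ.*-zeroʳ n

stirling1Transform : ℕ → (ℕ → ℚ) → ℚ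
stirling1Transform m f = Σ≤ m (λ k → ℕ→ℚ (unsignedStirling1 (suc m) (suc k)) * f k)

stirling1Transform-suc : ∀ m (f : ℕ → ℚ) →
  stirling1Transform (suc m) f ≡ stirling1Transform m (f ∘ suc) + ℕ→ℚ (suc m) * stirling1Transform m f
stirling1Transform-suc m f = begin
  Σ≤ (suc m) (λ k → ℕ→ℚ (unsignedStirling1 (suc (suc m)) (suc k)) * f k)
    ≡⟨ Σ<-cong (suc (suc m)) split ⟩
  Σ≤ (suc m) (λ k → c k * f k + r * (c (suc k) * f k))
    ≡⟨ Σ<-distrib-+ (suc (suc m)) (λ k → c k * f k) (λ k → r * (c (suc k) * f k)) ⟩
  Σ≤ (suc m) (λ k → c k * f k) + Σ≤ (suc m) (λ k → r * (c (suc k) * f k))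
    ≡⟨ cong₂ _+_ (Σ<-sucˡ (suc m) (λ k → c k * f k)) (sym (*-distribˡ-Σ< (suc (suc m)) r (λ k → c (suc k) * f k))) ⟩
  c 0 * f 0 + stirling1Transform m (f ∘ suc) + r * (stirling1Transform m f + c (suc (suc m)) * f (suc m))
    ≡⟨ cong (λ v → c 0 * f 0 + stirling1Transform m (f ∘ suc) + r * (stirling1Transform m f + ℕ→ℚ v * f (suc m)))
            (unsignedStirling1-vanishing (ℕ.n<1+n (suc m))) ⟩
  0ℚ * f 0 + stirling1Transform m (f ∘ suc) + r * (stirling1Transform m f + 0ℚ * f (suc m))
    ≡⟨ simplify (f 0) (stirling1Transform m (f ∘ suc)) r (stirling1Transform m f) (f (suc m)) ⟩
  stirling1Transform m (f ∘ suc) + r * stirling1Transform m f ∎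
  where
  open ≡-Reasoning
  r : ℚ
  r = ℕ→ℚ (suc m)
  c : ℕ → ℚ
  c k = ℕ→ℚ (unsignedStirling1 (suc m) k)
  distribute : ∀ a r b x → (a + r * b) * x ≡ a * x + r * (b * x)
  distribute = solve 4 (λ a r b x → (a :+ r :* b) :* x := a :* x :+ r :* (b :* x)) refl
  split : ∀ k → ℕ→ℚ (unsignedStirling1 (suc (suc m)) (suc k)) * f k ≡ c k * f k + r * (c (suc k) * f k)
  split k = trans (cong (_* f k) (trans (ℕ→ℚ-homo-+ (unsignedStirling1 (suc m) k) _)
                                        (cong (_+_ (c k)) (ℕ→ℚ-homo-* (suc m) (unsignedStirling1 (suc m) (suc k))))))
                  (distribute (c k) r (c (suc k)) (f k))
  simplify : ∀ x u r v y → 0ℚ * x + u + r * (v + 0ℚ * y) ≡ u + r * v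
  simplify = solve 5 (λ x u r v y → (con 0ℚ) :* x :+ u :+ r :* (v :+ (con 0ℚ) :* y) := u :+ r :* v) refl

bernoulliCombination : ℕ → ℕ → ℚ
bernoulliCombination m n = invFactorial m * stirling1Transform m (λ k → bernoulli (n ℕ.+ k))

bernoulliCombination-suc : ∀ m n →
  bernoulliCombination (suc m) n ≡ bernoulliCombination m n + bernoulliCombination m (suc n) * 1/ℕ (suc m)
bernoulliCombination-suc m n = begin
  invFactorial (suc m) * stirling1Transform (suc m) B
    ≡⟨ cong₂ _*_ (1/ℕ-homo-* (suc m) (m !)) (stirling1Transform-suc m B) ⟩
  (i * F) * (stirling1Transform m (B ∘ suc) + r * U)
    ≡⟨ cong (λ t → (i * F) * (t + r * U))
            (Σ<-cong (suc m) (λ k → cong (λ j → ℕ→ℚ (unsignedStirling1 (suc m) (suc k)) * bernoulli j) (ℕ.+-suc n k))) ⟩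
  (i * F) * (U′ + r * U)
    ≡⟨ regroup i F U′ r U ⟩
  F * U * (r * i) + F * U′ * i
    ≡⟨ cong (λ t → F * U * t + F * U′ * i) (1/ℕ-inverseʳ (suc m)) ⟩
  F * U * 1ℚ + F * U′ * i
    ≡⟨ cong (_+ F * U′ * i) (ℚ.*-identityʳ (F * U)) ⟩
  F * U + F * U′ * i ∎
  where
  open ≡-Reasoning
  instance
    m!≢0 : NonZero (m !)
    m!≢0 = m ℕ.!≢0
  B : ℕ → ℚ
  B k = bernoulli (n ℕ.+ k)
  i F r U U′ : ℚ
  i = 1/ℕ (suc m)
  F = invFactorial m
  r = ℕ→ℚ (suc m)
  U = stirling1Transform m B
  U′ = stirling1Transform m (λ k → bernoulli (suc n ℕ.+ k))
  regroup : ∀ i F U′ r U → (i * F) * (U′ + r * U) ≡ F * U * (r * i) + F * U′ * i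
  regroup = solve 5 (λ i F U′ r U → (i :* F) :* (U′ :+ r :* U) := F :* U :* (r :* i) :+ F :* U′ :* i) refl

stirling2Transform-weight≡bernoulliCombination : ∀ m n → stirling2Transform (weight m) n ≡ bernoulliCombination m n
stirling2Transform-weight≡bernoulliCombination zero n =
  trans (stirling2Transform-weight-zero≡bernoulli n) (trans (cong bernoulli (sym (ℕ.+-identityʳ n))) (unit (bernoulli (n ℕ.+ 0))))
  where
  unit : ∀ x → x ≡ 1ℚ * (0ℚ + 1ℚ * x)
  unit = solve 1 (λ x → x := (con 1ℚ) :* ((con 0ℚ) :+ (con 1ℚ) :* x)) refl
stirling2Transform-weight≡bernoulliCombination (suc m) n = begin
  stirling2Transform (weight (suc m)) n
    ≡⟨ stirling2Transform-weight-suc m n ⟩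
  stirling2Transform (weight m) n + stirling2Transform (weight m) (suc n) * 1/ℕ (suc m)
    ≡⟨ cong₂ (λ u v → u + v * 1/ℕ (suc m)) (stirling2Transform-weight≡bernoulliCombination m n)
                                           (stirling2Transform-weight≡bernoulliCombination m (suc n)) ⟩
  bernoulliCombination m n + bernoulliCombination m (suc n) * 1/ℕ (suc m)
    ≡⟨ bernoulliCombination-suc m n ⟨
  bernoulliCombination (suc m) n ∎
  where open ≡-Reasoning

theorem5 : (m : ℕ) → (n : ℕ) →
    let r = suc m in
    Σ≤ n (λ k → signPow k ℚ.* ((+ (k !)) / (r ℕ.+ k)) ℚ.* ℕ→ℚ (stirling2 n k))
      ≡ invFactorial (r ℕ.∸ 1) ℚ.* Σ≤ (r ℕ.∸ 1) (λ k → ℕ→ℚ ∣ stirling1 r (suc k) ∣ ℚ.* bernoulli (n ℕ.+ k))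
theorem5 m n = trans (stirling2Transform-weight≡bernoulliCombination m n) (cong (invFactorial m *_)
  (Σ<-cong (suc m) λ k → cong (λ c → ℕ→ℚ c * bernoulli (n ℕ.+ k)) (sym (∣stirling1∣≡unsignedStirling1 (suc m) (suc k)))))
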